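{- Let $n\ge1$ and let $s$ be an integer with $n/2<s\le n$. Let $T'$ consist of $\tilde\gamma_s$ together with all tuples of $\{0,1\}^n$ with exactly $\lfloor n/2\rfloor$ ones that are incomparable with $\tilde\gamma_s$, and let $T''$ consist of all tuples of $\{0,1\}^n$ with exactly $\lfloor n/2\rfloor+1$ ones that are incomparable with $\tilde\gamma_s$. Then $(T',T'')$ has the maximum cardinality among all pairs in $\mathcal A_s$.
   Context: $\{0,1\}^n$ is ordered componentwise; an antichain is a set of pairwise incomparable tuples. $\tilde\gamma_s$ is the tuple of $n-s$ zeros followed by $s$ ones. $\mathcal A_s$ is the set of pairs $(T',T'')$ of antichains in $\{0,1\}^n$ such that $\tilde\gamma_s\in T'$ and there are no $\tilde\alpha'\in T'$, $\tilde\alpha''\in T''$ with $\tilde\alpha'\ge\tilde\alpha''$. The cardinality of such a pair is $|T'|+|T''|$. -}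

module Defs where

open import Data.Bool using (Bool; true; false; _∧_; _∨_; not; if_then_else_)
import Data.Bool as B
import Data.Bool.Properties as BP
open import Data.Nat using (ℕ; zero; suc; _+_; _∸_; _≤ᵇ_; _≡ᵇ_)
open import Data.Nat.DivMod using (_/_)
open import Data.Fin using (Fin; toℕ)
open import Data.Vec using (Vec; []; _∷_; tabulate)
open import Data.Vec.Properties using (≡-dec)
open import Data.Vec.Relation.Binary.Pointwise.Inductive using (Pointwise; decidable)
open import Data.List using (List; [_]; _++_; map; length; filter)
open import Data.Product using (_×_)
open import Relation.Nullary using (¬_; Dec; yes; no)
open import Relation.Nullary.Decidable using (⌊_⌋)
open import Relation.Binary.PropositionalEquality using (_≡_)

-- Boolean tuples {0,1}^n (false = 0, true = 1)
Tuple : ℕ → Set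
Tuple n = Vec Bool n

_≤ᵗ_ : ∀ {n} → Tuple n → Tuple n → Set
_≤ᵗ_ = Pointwise B._≤_

_≤ᵗ?_ : ∀ {n} (a b : Tuple n) → Dec (a ≤ᵗ b)
_≤ᵗ?_ = decidable BP._≤?_

_≟ᵗ_ : ∀ {n} (a b : Tuple n) → Dec (a ≡ b)
_≟ᵗ_ = ≡-dec BP._≟_

ones : ∀ {n} → Tuple n → ℕ
ones [] = 0
ones (true ∷ a) = suc (ones a)
ones (false ∷ a) = ones a

-- γ̃_s : n - s zeros followed by s ones (position i, 0-based, is 1 iff n - s ≤ i)
gamma : (n s : ℕ) → Tuple n
gamma n s = tabulate (λ (i : Fin n) → (n ∸ s) ≤ᵇ toℕ i)

allTuples : (n : ℕ) → List (Tuple n)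
allTuples zero = [ [] ]
allTuples (suc n) = map (false ∷_) (allTuples n) ++ map (true ∷_) (allTuples n)

TSet : ℕ → Set
TSet n = Tuple n → Bool

_∈ˢ_ : ∀ {n} → Tuple n → TSet n → Set
a ∈ˢ S = S a ≡ true

card : ∀ {n} → TSet n → ℕ
card {n} S = length (filter (λ a → S a BP.≟ true) (allTuples n))

Antichain : ∀ {n} → TSet n → Set
Antichain S = ∀ a b → a ∈ˢ S → b ∈ˢ S → a ≤ᵗ b → a ≡ b

InA : (n s : ℕ) → TSet n → TSet n → Set
InA n s T′ T″ =
  Antichain T′ × Antichain T″ × gamma n s ∈ˢ T′ ×
  (∀ a b → a ∈ˢ T′ → b ∈ˢ T″ → ¬ (b ≤ᵗ a))

incomparableᵇ : ∀ {n} → Tuple n → Tuple n → Bool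
incomparableᵇ a b = not ⌊ a ≤ᵗ? b ⌋ ∧ not ⌊ b ≤ᵗ? a ⌋

T′ₛ : (n s : ℕ) → TSet n
T′ₛ n s a = ⌊ a ≟ᵗ gamma n s ⌋ ∨ ((ones a ≡ᵇ (n / 2)) ∧ incomparableᵇ a (gamma n s))

T″ₛ : (n s : ℕ) → TSet n
T″ₛ n s a = (ones a ≡ᵇ suc (n / 2)) ∧ incomparableᵇ a (gamma n s)

module Submission where

-- Write k = ⌊n/2⌋ and call a tuple "right of γ̃_s" if it has a one
-- among its first n - s coordinates, i.e. if it is not below γ̃_s.  For a pair
-- (S′,S″) in 𝒜_s the union A = S′ ∪ S″ is disjoint, contains no three distinct
-- comparable tuples, and every member other than γ̃_s is right of γ̃_s.  The pair
-- (T′,T″) consists of γ̃_s together with all tuples right of γ̃_s on the two middle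
-- levels k and k+1.  So it suffices to embed A ∖ {γ̃_s} into the right-of-γ̃_s
-- tuples of the middle levels.
--
-- The embedding uses the bracketing (de Bruijn–Tengbergen–Kruyswijk) symmetric
-- chain decomposition of {0,1}^n: every tuple has a chain and a position on it,
-- every chain runs symmetrically around the middle levels, and the tuples right of
-- γ̃_s occupy either no position of a chain or every position except possibly the
-- lowest.  On a single chain A has at most two members, and a purely arithmetical
-- selection lemma sends them injectively to middle positions that are right of γ̃_s.

open import Defs
open import Data.Bool using (Bool; true; false; _∧_; _∨_)
import Data.Bool as B
import Data.Bool.Properties as BP
open import Data.Nat
open import Data.Nat.Properties
open import Data.Nat.DivMod using (_/_; _%_; m≡m%n+[m/n]*n; m%n<n)
open import Data.Nat.Solver using (module +-*-Solver)
open import Data.Fin using (toℕ)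
open import Data.Vec using ([]; _∷_; tabulate)
open import Data.Vec.Properties using (tabulate-cong)
import Data.Vec.Relation.Binary.Pointwise.Inductive as Pointwise
open Pointwise using ([]; _∷_)
open import Data.List using (List; []; _∷_; _++_; map; length; filter)
open import Data.List.Properties using (length-++)
open import Data.List.Membership.Propositional using (_∈_)
open import Data.List.Membership.Propositional.Properties
  using (∈-∃++; ∈-++⁻; ∈-++⁺ˡ; ∈-++⁺ʳ; ∈-map⁺; ∈-map⁻; ∈-filter⁺; ∈-filter⁻)
open import Data.List.Relation.Unary.Any using (here; there)
import Data.List.Relation.Unary.All as All
open import Data.List.Relation.Unary.AllPairs using ([]; _∷_)
open import Data.List.Relation.Unary.Unique.Propositional using (Unique)
import Data.List.Relation.Unary.Unique.Propositional.Properties as Unique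
open import Data.Product using (_×_; _,_; proj₁; proj₂; ∃; uncurry)
open import Data.Sum using (_⊎_; inj₁; inj₂; [_,_]′) renaming (map to map-⊎)
open import Function.Base using (id)
open import Data.Empty using (⊥; ⊥-elim)
open import Data.Unit using (⊤; tt)
open import Function.Bundles using (Equivalence)
open import Relation.Nullary using (¬_; yes; no)
open import Relation.Binary.Definitions using (tri<; tri≈; tri>)
open import Relation.Binary.PropositionalEquality

true≢false : true ≢ false
true≢false ()

∨-true⁻ : ∀ a {b} → a ∨ b ≡ true → a ≡ true ⊎ b ≡ true
∨-true⁻ true  _ = inj₁ refl
∨-true⁻ false e = inj₂ e

∨-trueˡ : ∀ {a} b → a ≡ true → a ∨ b ≡ true
∨-trueˡ b refl = refl

∨-trueʳ : ∀ a {b} → b ≡ true → a ∨ b ≡ true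
∨-trueʳ a refl = BP.∨-zeroʳ a

∧-true⁺ : ∀ {a b} → a ≡ true → b ≡ true → a ∧ b ≡ true
∧-true⁺ refl e = e

≡ᵇ-true⁻ : ∀ {a b} → (a ≡ᵇ b) ≡ true → a ≡ b
≡ᵇ-true⁻ {a} {b} e = ≡ᵇ⇒≡ a b (Equivalence.from BP.T-≡ e)

≡ᵇ-true⁺ : ∀ {a b} → a ≡ b → (a ≡ᵇ b) ≡ true
≡ᵇ-true⁺ {a} {b} e = Equivalence.to BP.T-≡ (≡⇒≡ᵇ a b e)

≤ᵗ-refl : ∀ {n} (a : Tuple n) → a ≤ᵗ a
≤ᵗ-refl _ = Pointwise.refl BP.≤-refl

Incomparable : ∀ {n} → Tuple n → Tuple n → Set
Incomparable a b = ¬ (a ≤ᵗ b) × ¬ (b ≤ᵗ a)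

incomparableᵇ⁻ : ∀ {n} (a b : Tuple n) → incomparableᵇ a b ≡ true → Incomparable a b
incomparableᵇ⁻ a b e with a ≤ᵗ? b | b ≤ᵗ? a
... | no a≰b | no b≰a = a≰b , b≰a

incomparableᵇ⁺ : ∀ {n} (a b : Tuple n) → Incomparable a b → incomparableᵇ a b ≡ true
incomparableᵇ⁺ a b (a≰b , b≰a) with a ≤ᵗ? b | b ≤ᵗ? a
... | yes a≤b | _       = ⊥-elim (a≰b a≤b)
... | no _    | yes b≤a = ⊥-elim (b≰a b≤a)
... | no _    | no _    = refl

ones-mono : ∀ {n} {a b : Tuple n} → a ≤ᵗ b → ones a ≤ ones b
ones-mono [] = z≤n
ones-mono {a = false ∷ _} {false ∷ _} (_ ∷ ps) = ones-mono ps
ones-mono {a = false ∷ _} {true ∷ _}  (_ ∷ ps) = m≤n⇒m≤1+n (ones-mono ps)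
ones-mono {a = true ∷ _}  {true ∷ _}  (_ ∷ ps) = s≤s (ones-mono ps)

same-level : ∀ {n} {a b : Tuple n} → a ≤ᵗ b → ones a ≡ ones b → a ≡ b
same-level [] _ = refl
same-level {a = false ∷ _} {false ∷ _} (_ ∷ ps) e = cong (false ∷_) (same-level ps e)
same-level {a = false ∷ _} {true ∷ _}  (_ ∷ ps) e =
  ⊥-elim (<⇒≱ (s≤s (ones-mono ps)) (≤-reflexive (sym e)))
same-level {a = true ∷ _}  {true ∷ _}  (_ ∷ ps) e = cong (true ∷_) (same-level ps (suc-injective e))

-- Counting.  card S is the length of S filtered out of a duplicate-free enumeration
-- of the cube, so injections and disjoint unions are counted on lists.
length-injection : ∀ {A B : Set} (f : A → B) (xs : List A) (ys : List B) → Unique xs →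
  (∀ {x} → x ∈ xs → f x ∈ ys) → (∀ {x y} → x ∈ xs → y ∈ xs → f x ≡ f y → x ≡ y) →
  length xs ≤ length ys
length-injection f [] ys _ _ _ = z≤n
length-injection f (x ∷ xs) ys (x∉xs ∷ unique) maps inj with ∈-∃++ (maps (here refl))
... | ys₁ , ys₂ , refl = begin
    suc (length xs)                  ≤⟨ s≤s (length-injection f xs (ys₁ ++ ys₂) unique maps′ inj′) ⟩
    suc (length (ys₁ ++ ys₂))        ≡⟨ cong suc (length-++ ys₁) ⟩
    suc (length ys₁ + length ys₂)    ≡⟨ +-suc (length ys₁) (length ys₂) ⟨
    length ys₁ + length (f x ∷ ys₂)  ≡⟨ length-++ ys₁ ⟨
    length (ys₁ ++ f x ∷ ys₂)        ∎
  where
  open ≤-Reasoning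
  maps′ : ∀ {y} → y ∈ xs → f y ∈ ys₁ ++ ys₂
  maps′ {y} y∈ with ∈-++⁻ ys₁ (maps (there y∈))
  ... | inj₁ p = ∈-++⁺ˡ p
  ... | inj₂ (here e) = ⊥-elim (All.lookup x∉xs y∈ (sym (inj (there y∈) (here refl) e)))
  ... | inj₂ (there p) = ∈-++⁺ʳ ys₁ p
  inj′ : ∀ {y z} → y ∈ xs → z ∈ xs → f y ≡ f z → y ≡ z
  inj′ p q = inj (there p) (there q)

allTuples-complete : ∀ {n} (a : Tuple n) → a ∈ allTuples n
allTuples-complete [] = here refl
allTuples-complete {suc n} (false ∷ a) = ∈-++⁺ˡ (∈-map⁺ (false ∷_) (allTuples-complete a))
allTuples-complete {suc n} (true ∷ a) =
  ∈-++⁺ʳ (map (false ∷_) (allTuples n)) (∈-map⁺ (true ∷_) (allTuples-complete a))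

allTuples-unique : ∀ n → Unique (allTuples n)
allTuples-unique zero = All.[] ∷ []
allTuples-unique (suc n) =
  Unique.++⁺ (Unique.map⁺ ∷-injectiveʳ (allTuples-unique n))
             (Unique.map⁺ ∷-injectiveʳ (allTuples-unique n)) heads-differ
  where
  ∷-injectiveʳ : ∀ {b} {x y : Tuple n} → (b ∷ x) ≡ (b ∷ y) → x ≡ y
  ∷-injectiveʳ refl = refl
  heads-differ : ∀ {v} → ¬ (v ∈ map (false ∷_) (allTuples n) × v ∈ map (true ∷_) (allTuples n))
  heads-differ (p , q) with ∈-map⁻ (false ∷_) p | ∈-map⁻ (true ∷_) q
  ... | _ , _ , refl | _ , _ , ()

card-injection : ∀ {n} (P Q : TSet n) (f : Tuple n → Tuple n) →
  (∀ a → a ∈ˢ P → f a ∈ˢ Q) → (∀ a b → a ∈ˢ P → b ∈ˢ P → f a ≡ f b → a ≡ b) →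
  card P ≤ card Q
card-injection {n} P Q f maps inj =
  length-injection f _ _ (Unique.filter⁺ P? (allTuples-unique n)) maps′
    (λ p q → inj _ _ (member p) (member q))
  where
  P? = λ a → P a BP.≟ true
  member : ∀ {a} → a ∈ filter P? (allTuples n) → a ∈ˢ P
  member p = proj₂ (∈-filter⁻ P? {xs = allTuples n} p)
  maps′ : ∀ {a} → a ∈ filter P? (allTuples n) → f a ∈ filter (λ b → Q b BP.≟ true) (allTuples n)
  maps′ p = ∈-filter⁺ _ (allTuples-complete _) (maps _ (member p))

card-disjoint-union : ∀ {n} (P Q : TSet n) → (∀ a → a ∈ˢ P → Q a ≡ false) →
  card P + card Q ≡ card (λ a → P a ∨ Q a)
card-disjoint-union {n} P Q disjoint = count (allTuples n)
  where
  count : ∀ xs → length (filter (λ a → P a BP.≟ true) xs) + length (filter (λ a → Q a BP.≟ true) xs)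
                 ≡ length (filter (λ a → (P a ∨ Q a) BP.≟ true) xs)
  count [] = refl
  count (x ∷ xs) with P x in p | Q x in q
  ... | true  | true  = ⊥-elim (true≢false (trans (sym q) (disjoint x p)))
  ... | true  | false = cong suc (count xs)
  ... | false | true  = trans (+-suc _ _) (cong suc (count xs))
  ... | false | false = count xs

halves : ∀ n → n ≡ n / 2 + n / 2 + n % 2
halves n = trans (m≡m%n+[m/n]*n n 2) (rearrange (n % 2) (n / 2))
  where
  open +-*-Solver
  rearrange : ∀ r q → r + q * 2 ≡ q + q + r
  rearrange = solve 2 (λ r q → r :+ q :* con 2 := q :+ q :+ r) refl

parity≤1 : ∀ n → n % 2 ≤ 1
parity≤1 n = ≤-pred (m%n<n n 2)

middle<s : ∀ n s → n < 2 * s → n / 2 < s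
middle<s n s n<2s with n / 2 <? s
... | yes k<s = k<s
... | no k≮s = ⊥-elim (<⇒≱ n<2s (begin
    2 * s                      ≡⟨ cong (s +_) (+-identityʳ s) ⟩
    s + s                      ≤⟨ +-mono-≤ (≮⇒≥ k≮s) (≮⇒≥ k≮s) ⟩
    n / 2 + n / 2              ≤⟨ m≤m+n _ (n % 2) ⟩
    n / 2 + n / 2 + n % 2      ≡⟨ halves n ⟨
    n                          ∎))
  where open ≤-Reasoning

symmetric-start≤middle : ∀ n b L → b + b + L ≡ n → b ≤ n / 2
symmetric-start≤middle n b L sym-chain with b ≤? n / 2
... | yes b≤k = b≤k
... | no b≰k = ⊥-elim (<⇒≱ below-next-middle (begin
    suc k + suc k            ≤⟨ +-mono-≤ (≰⇒> b≰k) (≰⇒> b≰k) ⟩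
    b + b                    ≤⟨ m≤m+n (b + b) L ⟩
    b + b + L                ≡⟨ trans sym-chain (halves n) ⟩
    k + k + n % 2            ∎))
  where
  open ≤-Reasoning
  k = n / 2
  below-next-middle : k + k + n % 2 < suc k + suc k
  below-next-middle = begin-strict
    k + k + n % 2            ≤⟨ +-monoʳ-≤ (k + k) (parity≤1 n) ⟩
    k + k + 1                ≡⟨ +-assoc k k 1 ⟩
    k + (k + 1)              ≡⟨ cong (k +_) (+-comm k 1) ⟩
    k + suc k                <⟨ n<1+n _ ⟩
    suc k + suc k            ∎

symmetric-length : ∀ n b L → b + b + L ≡ n → L ≡ (n / 2 ∸ b) + (n / 2 ∸ b) + n % 2
symmetric-length n b L sym-chain = +-cancelˡ-≡ (b + b) L _ (begin
    b + b + L                       ≡⟨ sym-chain ⟩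
    n                               ≡⟨ halves n ⟩
    k + k + n % 2                   ≡⟨ cong (λ t → t + t + n % 2) b+d≡k ⟨
    (b + d) + (b + d) + n % 2       ≡⟨ rearrange b d (n % 2) ⟩
    (b + b) + (d + d + n % 2)       ∎)
  where
  open ≡-Reasoning
  open +-*-Solver
  k = n / 2
  d = k ∸ b
  b+d≡k : b + d ≡ k
  b+d≡k = m+[n∸m]≡n (symmetric-start≤middle n b L sym-chain)
  rearrange : ∀ b d r → (b + d) + (b + d) + r ≡ (b + b) + (d + d + r)
  rearrange = solve 3 (λ b d r → (b :+ d) :+ (b :+ d) :+ r := (b :+ b) :+ (d :+ d :+ r)) refl

-- The bracketing symmetric chain decomposition of {0,1}^n
--
-- Read a tuple as a bracket word (0 = opening, 1 = closing bracket).  A chain is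
-- the matched structure of such a word: reading coordinates from the first,
-- 'free' is an unmatched coordinate and 'close' is a 0 that is matched with the
-- first unmatched coordinate of the rest, which is thereby a 1.  The tuple at
-- position i of a chain has its first i unmatched coordinates equal to 1 and
-- the others equal to 0.

data Chain : ℕ → Set where
  ∅     : Chain 0
  free  : ∀ {n} → Chain n → Chain (suc n)
  close : ∀ {n} → Chain n → Chain (suc n)

-- number of unmatched coordinates: the chain has positions 0, …, width c
width : ∀ {n} → Chain n → ℕ
width ∅ = 0
width (free c) = suc (width c)
width (close c) = pred (width c)

-- number of ones forced by matched pairs: the level of position 0
forced : ∀ {n} → Chain n → ℕ
forced ∅ = 0
forced (free c) = forced c
forced (close c) = suc (forced c)

-- every 'close' has an unmatched coordinate to match with
Valid : ∀ {n} → Chain n → Set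
Valid ∅ = ⊤
Valid (free c) = Valid c
Valid (close c) = Valid c × 1 ≤ width c

at : ∀ {n} → Chain n → ℕ → Tuple n
at ∅ _ = []
at (free c) zero = false ∷ at c 0
at (free c) (suc i) = true ∷ at c i
at (close c) i = false ∷ at c (suc i)

locate : ∀ {n} → Tuple n → Chain n × ℕ
locate [] = ∅ , 0
locate (false ∷ x) with locate x
... | c , zero = free c , zero
... | c , suc i = close c , i
locate (true ∷ x) with locate x
... | c , i = free c , suc i

chainOf : ∀ {n} → Tuple n → Chain n
chainOf x = proj₁ (locate x)

positionOf : ∀ {n} → Tuple n → ℕ
positionOf x = proj₂ (locate x)

at-locate : ∀ {n} (x : Tuple n) → at (chainOf x) (positionOf x) ≡ x
at-locate [] = refl
at-locate (false ∷ x) with locate x | at-locate x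
... | c , zero  | e = cong (false ∷_) e
... | c , suc i | e = cong (false ∷_) e
at-locate (true ∷ x) with locate x | at-locate x
... | c , i | e = cong (true ∷_) e

locate-valid : ∀ {n} (x : Tuple n) → Valid (chainOf x) × positionOf x ≤ width (chainOf x)
locate-valid [] = tt , z≤n
locate-valid (false ∷ x) with locate x | locate-valid x
... | c , zero  | v , _ = v , z≤n
... | c , suc i | v , i<w = (v , ≤-trans (s≤s z≤n) i<w) , pred-mono-≤ i<w
locate-valid (true ∷ x) with locate x | locate-valid x
... | c , i | v , i≤w = v , s≤s i≤w

suc≤ : ∀ {j} w → 1 ≤ w → j ≤ pred w → suc j ≤ w
suc≤ (suc w) _ j≤ = s≤s j≤

locate-at : ∀ {n} (c : Chain n) i → Valid c → i ≤ width c → locate (at c i) ≡ (c , i)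
locate-at ∅ zero _ _ = refl
locate-at (free c) zero v _ rewrite locate-at c 0 v z≤n = refl
locate-at (free c) (suc i) v (s≤s i≤w) rewrite locate-at c i v i≤w = refl
locate-at (close c) i (v , w≥1) i≤w rewrite locate-at c (suc i) v (suc≤ (width c) w≥1 i≤w) = refl

at-injective : ∀ {n} (c : Chain n) i j → Valid c → i ≤ width c → j ≤ width c → at c i ≡ at c j → i ≡ j
at-injective c i j v i≤w j≤w e =
  cong proj₂ (trans (sym (locate-at c i v i≤w)) (trans (cong locate e) (locate-at c j v j≤w)))

at-mono : ∀ {n} (c : Chain n) i j → i ≤ j → at c i ≤ᵗ at c j
at-mono ∅ _ _ _ = []
at-mono (free c) zero zero _ = B.b≤b ∷ at-mono c 0 0 z≤n
at-mono (free c) zero (suc j) _ = B.f≤t ∷ at-mono c 0 j z≤n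
at-mono (free c) (suc i) (suc j) (s≤s i≤j) = B.b≤b ∷ at-mono c i j i≤j
at-mono (close c) i j i≤j = B.b≤b ∷ at-mono c (suc i) (suc j) (s≤s i≤j)

ones-at : ∀ {n} (c : Chain n) j → Valid c → j ≤ width c → ones (at c j) ≡ forced c + j
ones-at ∅ zero _ _ = refl
ones-at (free c) zero v _ = ones-at c 0 v z≤n
ones-at (free c) (suc j) v (s≤s j≤w) rewrite ones-at c j v j≤w = sym (+-suc (forced c) j)
ones-at (close c) j (v , w≥1) j≤w rewrite ones-at c (suc j) v (suc≤ (width c) w≥1 j≤w) = +-suc (forced c) j

chain-symmetric : ∀ {n} (c : Chain n) → Valid c → forced c + forced c + width c ≡ n
chain-symmetric ∅ _ = refl
chain-symmetric (free c) v = trans (+-suc (forced c + forced c) (width c)) (cong suc (chain-symmetric c v))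
chain-symmetric (close c) (v , w≥1) = step (forced c) (width c) w≥1 (chain-symmetric c v)
  where
  step : ∀ b w {n} → 1 ≤ w → b + b + w ≡ n → suc b + suc b + pred w ≡ suc n
  step b (suc w) _ refl = cong suc (trans (cong (_+ w) (+-suc b b)) (sym (+-suc (b + b) w)))

-- hasOne m x: x has a one among its first m coordinates.  For m = n - s these are
-- exactly the tuples not below γ̃_s, the tuples "right of γ̃_s".
hasOne : ℕ → ∀ {n} → Tuple n → Bool
hasOne zero _ = false
hasOne (suc m) [] = false
hasOne (suc m) (b ∷ x) = b ∨ hasOne m x

-- Along any chain, hasOne m holds at every position except possibly position 0,
-- or at no position at all.  (A 'close' shifts positions by one, and the
-- first coordinate of 'free c' is 1 at every positive position.)
Profile : (w : ℕ) → (ℕ → Bool) → Set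
Profile w q = (∀ j → 1 ≤ j → j ≤ w → q j ≡ true) ⊎ (∀ j → j ≤ w → q j ≡ false)

hasOne-profile : ∀ {n} m (c : Chain n) → Profile (width c) (λ j → hasOne m (at c j))
hasOne-profile zero c = inj₂ (λ _ _ → refl)
hasOne-profile (suc m) ∅ = inj₂ (λ _ _ → refl)
hasOne-profile (suc m) (free c) = inj₁ λ { (suc j) _ _ → refl }
hasOne-profile (suc m) (close c) with hasOne-profile m c
... | inj₁ above = inj₁ (λ j j≥1 j≤w →
  above (suc j) (s≤s z≤n) (suc≤ (width c) (≤-trans j≥1 (≤-trans j≤w pred[n]≤n)) j≤w))
... | inj₂ none with width c
...   | zero = inj₁ (λ { j (s≤s z≤n) () })
...   | suc w = inj₂ (λ j j≤w → none (suc j) (s≤s j≤w))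

private
  suc≤ᵇsuc : ∀ a j → (suc a ≤ᵇ suc j) ≡ (a ≤ᵇ j)
  suc≤ᵇsuc zero j = refl
  suc≤ᵇsuc (suc a) j = refl

gamma-suc : ∀ n s → s ≤ n → gamma (suc n) s ≡ false ∷ gamma n s
gamma-suc n s s≤n = begin
    tabulate (λ i → (suc n ∸ s) ≤ᵇ toℕ i)
  ≡⟨ tabulate-cong (λ i → cong (_≤ᵇ toℕ i) (+-∸-assoc 1 s≤n)) ⟩
    tabulate (λ i → suc (n ∸ s) ≤ᵇ toℕ i)
  ≡⟨ cong (false ∷_) (tabulate-cong (λ i → suc≤ᵇsuc (n ∸ s) (toℕ i))) ⟩
    false ∷ gamma n s ∎
  where open ≡-Reasoning

gamma-top : ∀ n → gamma n n ≡ tabulate (λ _ → true)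
gamma-top n = tabulate-cong (λ i → cong (_≤ᵇ toℕ i) (n∸n≡0 n))

below-top : ∀ {n} (x : Tuple n) → x ≤ᵗ tabulate (λ _ → true)
below-top [] = []
below-top (false ∷ x) = B.f≤t ∷ below-top x
below-top (true ∷ x) = B.b≤b ∷ below-top x

ones-top : ∀ n → ones (tabulate {n = n} (λ _ → true)) ≡ n
ones-top zero = refl
ones-top (suc n) = cong suc (ones-top n)

ones-gamma : ∀ n s → s ≤ n → ones (gamma n s) ≡ s
ones-gamma zero zero z≤n = refl
ones-gamma (suc n) s s≤n with m≤n⇒m<n∨m≡n s≤n
... | inj₂ refl rewrite gamma-top (suc n) = ones-top (suc n)
... | inj₁ (s≤s s≤n′) rewrite gamma-suc n s s≤n′ = ones-gamma n s s≤n′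

below-gamma⇒¬hasOne : ∀ n s → s ≤ n → (x : Tuple n) → x ≤ᵗ gamma n s → hasOne (n ∸ s) x ≡ false
below-gamma⇒¬hasOne zero zero z≤n x _ = refl
below-gamma⇒¬hasOne (suc n) s s≤n x x≤γ with m≤n⇒m<n∨m≡n s≤n
... | inj₂ refl rewrite n∸n≡0 (suc n) = refl
... | inj₁ (s≤s s≤n′) rewrite gamma-suc n s s≤n′ | +-∸-assoc 1 s≤n′ with x | x≤γ
...   | false ∷ x′ | _ ∷ x′≤γ = below-gamma⇒¬hasOne n s s≤n′ x′ x′≤γ

¬hasOne⇒below-gamma : ∀ n s → s ≤ n → (x : Tuple n) → hasOne (n ∸ s) x ≡ false → x ≤ᵗ gamma n s
¬hasOne⇒below-gamma zero zero z≤n [] _ = []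
¬hasOne⇒below-gamma (suc n) s s≤n x none with m≤n⇒m<n∨m≡n s≤n
... | inj₂ refl rewrite gamma-top (suc n) = below-top x
... | inj₁ (s≤s s≤n′) rewrite gamma-suc n s s≤n′ | +-∸-assoc 1 s≤n′ with x | none
...   | false ∷ x′ | none′ = B.b≤b ∷ ¬hasOne⇒below-gamma n s s≤n′ x′ none′

-- Selecting middle positions on one chain
--
-- Positions 0, …, w of a chain with w = d + d + r (r ≤ 1) meet the middle levels
-- at d and d + 1.  Given the profile q of an up-set as above and a set F ⊆ q of
-- positions without three members, the lowest member of F is sent to d (or to
-- d + 1 if q fails at d) and any higher member to d + 1.

someBelow : (ℕ → Bool) → ℕ → Bool
someBelow F zero = false
someBelow F (suc j) = F j ∨ someBelow F j

someBelow⁻ : ∀ F i → someBelow F i ≡ true → ∃ λ j → j < i × F j ≡ true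
someBelow⁻ F (suc i) e with ∨-true⁻ (F i) e
... | inj₁ Fi = i , ≤-refl , Fi
... | inj₂ below with someBelow⁻ F i below
...   | j , j<i , Fj = j , m≤n⇒m≤1+n j<i , Fj

someBelow⁺ : ∀ F i j → j < i → F j ≡ true → someBelow F i ≡ true
someBelow⁺ F (suc i) j j<1+i Fj with m≤n⇒m<n∨m≡n (≤-pred j<1+i)
... | inj₁ j<i = ∨-trueʳ (F i) (someBelow⁺ F i j j<i Fj)
... | inj₂ refl rewrite Fj = refl

choose : Bool → Bool → ℕ → ℕ
choose true  _     d = suc d
choose false true  d = d
choose false false d = suc d

target : ℕ → (q F : ℕ → Bool) → ℕ → ℕ
target d q F i = choose (someBelow F i) (q d) d

module Selection (w d r : ℕ) (w≡ : w ≡ d + d + r) (r≤1 : r ≤ 1) (q F : ℕ → Bool)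
  (profile : Profile w q) (F⊆q : ∀ j → F j ≡ true → q j ≡ true)
  (no-three : ∀ i j l → i < j → j < l → l ≤ w → F i ≡ true → F j ≡ true → F l ≡ true → ⊥)
  where

  d≤w : d ≤ w
  d≤w = subst (d ≤_) (sym w≡) (≤-trans (m≤m+n d d) (m≤m+n (d + d) r))

  suc-d≤w : 1 ≤ w → suc d ≤ w
  suc-d≤w w≥1 = subst (suc d ≤_) (sym w≡) (middle d (subst (1 ≤_) w≡ w≥1))
    where
    middle : ∀ d → 1 ≤ d + d + r → suc d ≤ d + d + r
    middle zero w≥1 = w≥1
    middle (suc d) _ = s≤s (≤-trans (m≤n+m (suc d) d) (m≤m+n (d + suc d) r))

  q-positive : ∀ i → i ≤ w → F i ≡ true → ∀ j → 1 ≤ j → j ≤ w → q j ≡ true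
  q-positive i i≤w Fi =
    [ id , (λ none → ⊥-elim (true≢false (trans (sym (F⊆q i Fi)) (none i i≤w)))) ]′ profile

  q-fails-at-d : ∀ i → i ≤ w → F i ≡ true → q d ≡ false → d ≡ 0 × 1 ≤ i
  q-fails-at-d i i≤w Fi qd = d≡0 , positive i Fi (subst (λ t → q t ≡ false) d≡0 qd)
    where
    bottom : ∀ e → e ≤ w → q e ≡ false → e ≡ 0
    bottom zero _ _ = refl
    bottom (suc e) e≤w qe =
      ⊥-elim (true≢false (trans (sym (q-positive i i≤w Fi (suc e) (s≤s z≤n) e≤w)) qe))
    d≡0 : d ≡ 0
    d≡0 = bottom d d≤w qd
    positive : ∀ j → F j ≡ true → q 0 ≡ false → 1 ≤ j
    positive zero Fj q0 = ⊥-elim (true≢false (trans (sym (F⊆q 0 Fj)) q0))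
    positive (suc j) _ _ = s≤s z≤n

  Admissible : ℕ → Set
  Admissible t = t ≤ w × q t ≡ true × (t ≡ d ⊎ t ≡ suc d)

  upper-admissible : ∀ i → i ≤ w → F i ≡ true → 1 ≤ w → Admissible (suc d)
  upper-admissible i i≤w Fi w≥1 =
    suc-d≤w w≥1 , q-positive i i≤w Fi (suc d) (s≤s z≤n) (suc-d≤w w≥1) , inj₂ refl

  target-admissible : ∀ i → i ≤ w → F i ≡ true → Admissible (target d q F i)
  target-admissible i i≤w Fi with someBelow F i in below | q d in qd
  ... | true | _ with someBelow⁻ F i below
  ...   | j , j<i , _ = upper-admissible i i≤w Fi (≤-trans (s≤s z≤n) (≤-trans j<i i≤w))
  target-admissible i i≤w Fi | false | true = d≤w , qd , inj₁ refl
  target-admissible i i≤w Fi | false | false =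
    upper-admissible i i≤w Fi (≤-trans (proj₂ (q-fails-at-d i i≤w Fi qd)) i≤w)

  -- Below a higher member i′ lies the member i, so i′ goes to d + 1.  Then i goes
  -- to d only if it is the lowest member, and to d + 1 only when q fails at d,
  -- which squeezes the chain to w ≤ 1 with no room for i < i′.
  distinct-targets : ∀ i i′ → i < i′ → i′ ≤ w → F i ≡ true → F i′ ≡ true →
    target d q F i ≢ target d q F i′
  distinct-targets i i′ i<i′ i′≤w Fi Fi′ e = separate (trans e (upper (someBelow⁺ F i′ i i<i′ Fi)))
    where
    upper : someBelow F i′ ≡ true → target d q F i′ ≡ suc d
    upper below rewrite below = refl
    separate : target d q F i ≢ suc d
    separate e′ with someBelow F i in below | q d in qd
    ... | true | _ with someBelow⁻ F i below
    ...   | j , j<i , Fj = no-three j i i′ j<i i<i′ i′≤w Fj Fi Fi′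
    separate e′ | false | true = 1+n≢n (sym e′)
    separate e′ | false | false with q-fails-at-d i (≤-trans (<⇒≤ i<i′) i′≤w) Fi qd
    ... | refl , 1≤i = <⇒≱ (≤-trans (s≤s 1≤i) i<i′) (≤-trans i′≤w (subst (_≤ 1) (sym w≡) r≤1))

  target-injective : ∀ i i′ → i ≤ w → i′ ≤ w → F i ≡ true → F i′ ≡ true →
    target d q F i ≡ target d q F i′ → i ≡ i′
  target-injective i i′ i≤w i′≤w Fi Fi′ e with <-cmp i i′
  ... | tri< i<i′ _ _ = ⊥-elim (distinct-targets i i′ i<i′ i′≤w Fi Fi′ e)
  ... | tri≈ _ i≡i′ _ = i≡i′
  ... | tri> _ _ i′<i = ⊥-elim (distinct-targets i′ i i′<i i≤w Fi′ Fi (sym e))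

-- S′ and S″ are disjoint: a common member would lie below itself.
InA-disjoint : ∀ {n s} (S′ S″ : TSet n) → InA n s S′ S″ → ∀ a → a ∈ˢ S′ → S″ a ≡ false
InA-disjoint S′ S″ (_ , _ , _ , cross) a a∈S′ with S″ a in a∈S″
... | true = ⊥-elim (cross a a a∈S′ a∈S″ (≤ᵗ-refl a))
... | false = refl

-- S′ ∪ S″ contains no three distinct tuples x < y < z: two of them would lie in
-- the same antichain, or a member of S″ would lie below a member of S′.
InA-no-three : ∀ {n s} (S′ S″ : TSet n) → InA n s S′ S″ → ∀ x y z →
  S′ x ∨ S″ x ≡ true → S′ y ∨ S″ y ≡ true → S′ z ∨ S″ z ≡ true →
  x ≤ᵗ y → y ≤ᵗ z → x ≢ y → y ≢ z → ⊥
InA-no-three S′ S″ (anti′ , anti″ , _ , cross) x y z x∈ y∈ z∈ x≤y y≤z x≢y y≢z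
  with ∨-true⁻ (S′ x) x∈ | ∨-true⁻ (S′ y) y∈ | ∨-true⁻ (S′ z) z∈
... | inj₁ x∈S′ | inj₁ y∈S′ | _         = x≢y (anti′ x y x∈S′ y∈S′ x≤y)
... | inj₂ x∈S″ | inj₁ y∈S′ | _         = cross y x y∈S′ x∈S″ x≤y
... | inj₂ x∈S″ | inj₂ y∈S″ | _         = x≢y (anti″ x y x∈S″ y∈S″ x≤y)
... | inj₁ _    | inj₂ y∈S″ | inj₂ z∈S″ = y≢z (anti″ y z y∈S″ z∈S″ y≤z)
... | inj₁ _    | inj₂ y∈S″ | inj₁ z∈S′ = cross z y z∈S′ y∈S″ y≤z

-- The only member of S′ ∪ S″ below γ̃_s is γ̃_s itself: S′ is an antichain
-- containing γ̃_s, and no member of S″ lies below γ̃_s ∈ S′.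
InA-below-gamma : ∀ {n s} (S′ S″ : TSet n) → InA n s S′ S″ → ∀ a →
  S′ a ∨ S″ a ≡ true → a ≤ᵗ gamma n s → a ≡ gamma n s
InA-below-gamma S′ S″ (anti′ , _ , γ∈S′ , cross) a a∈ a≤γ with ∨-true⁻ (S′ a) a∈
... | inj₁ a∈S′ = anti′ a _ a∈S′ γ∈S′ a≤γ
... | inj₂ a∈S″ = ⊥-elim (cross _ a γ∈S′ a∈S″ a≤γ)

module Extremal (n s : ℕ) (s≤n : s ≤ n) (k<s : n / 2 < s) where

  k m : ℕ
  k = n / 2
  m = n ∸ s

  γ : Tuple n
  γ = gamma n s

  T′-member : ∀ a → a ∈ˢ T′ₛ n s → a ≡ γ ⊎ (ones a ≡ k × Incomparable a γ)
  T′-member a a∈T′ with a ≟ᵗ γ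
  ... | yes a≡γ = inj₁ a≡γ
  ... | no _ = inj₂ ( ≡ᵇ-true⁻ (BP.∧-conicalˡ (ones a ≡ᵇ k) _ a∈T′)
                    , incomparableᵇ⁻ a γ (BP.∧-conicalʳ (ones a ≡ᵇ k) _ a∈T′))

  T″-member : ∀ a → a ∈ˢ T″ₛ n s → ones a ≡ suc k × Incomparable a γ
  T″-member a a∈T″ = ≡ᵇ-true⁻ (BP.∧-conicalˡ (ones a ≡ᵇ suc k) _ a∈T″)
                    , incomparableᵇ⁻ a γ (BP.∧-conicalʳ (ones a ≡ᵇ suc k) _ a∈T″)

  γ∈T′ : γ ∈ˢ T′ₛ n s
  γ∈T′ with γ ≟ᵗ γ
  ... | yes _ = refl
  ... | no γ≢γ = ⊥-elim (γ≢γ refl)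

  T′-intro : ∀ a → ones a ≡ k → Incomparable a γ → a ∈ˢ T′ₛ n s
  T′-intro a level incomparable =
    ∨-trueʳ _ (∧-true⁺ (≡ᵇ-true⁺ level) (incomparableᵇ⁺ a γ incomparable))

  T″-intro : ∀ a → ones a ≡ suc k → Incomparable a γ → a ∈ˢ T″ₛ n s
  T″-intro a level incomparable = ∧-true⁺ (≡ᵇ-true⁺ level) (incomparableᵇ⁺ a γ incomparable)

  -- The first half of corollary5: (T′, T″) belongs to 𝒜_s, because levels are
  -- antichains and γ̃_s is incomparable with the other members.
  extremal-pair-in-A : InA n s (T′ₛ n s) (T″ₛ n s)
  extremal-pair-in-A = antichain′ , antichain″ , γ∈T′ , cross
    where
    antichain′ : Antichain (T′ₛ n s)
    antichain′ a b a∈ b∈ a≤b with T′-member a a∈ | T′-member b b∈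
    ... | inj₁ a≡γ | inj₁ b≡γ = trans a≡γ (sym b≡γ)
    ... | inj₁ refl | inj₂ (_ , b∥γ) = ⊥-elim (proj₂ b∥γ a≤b)
    ... | inj₂ (_ , a∥γ) | inj₁ refl = ⊥-elim (proj₁ a∥γ a≤b)
    ... | inj₂ (level-a , _) | inj₂ (level-b , _) = same-level a≤b (trans level-a (sym level-b))
    antichain″ : Antichain (T″ₛ n s)
    antichain″ a b a∈ b∈ a≤b =
      same-level a≤b (trans (proj₁ (T″-member a a∈)) (sym (proj₁ (T″-member b b∈))))
    cross : ∀ a b → a ∈ˢ T′ₛ n s → b ∈ˢ T″ₛ n s → ¬ (b ≤ᵗ a)
    cross a b a∈ b∈ b≤a with T′-member a a∈ | T″-member b b∈
    ... | inj₁ refl | _ , b∥γ = proj₁ b∥γ b≤a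
    ... | inj₂ (level-a , _) | level-b , _ =
      <⇒≱ (≤-reflexive (cong suc level-a)) (subst (_≤ ones a) level-b (ones-mono b≤a))

  γ-not-right : hasOne m γ ≡ false
  γ-not-right = below-gamma⇒¬hasOne n s s≤n γ (≤ᵗ-refl γ)

  -- A tuple right of γ̃_s on a level at most k + 1 ≤ s is incomparable with γ̃_s:
  -- it is not below γ̃_s, and above γ̃_s it would have to equal γ̃_s.
  right-incomparable : ∀ y → hasOne m y ≡ true → ones y ≤ suc k → Incomparable y γ
  right-incomparable y right low = y≰γ , γ≰y
    where
    y≰γ : ¬ (y ≤ᵗ γ)
    y≰γ y≤γ = true≢false (trans (sym right) (below-gamma⇒¬hasOne n s s≤n y y≤γ))
    γ≰y : ¬ (γ ≤ᵗ y)
    γ≰y γ≤y = y≰γ (subst (_≤ᵗ γ) (same-level γ≤y level) (≤ᵗ-refl γ))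
      where
      level : ones γ ≡ ones y
      level = ≤-antisym (ones-mono γ≤y)
        (≤-trans low (subst (suc k ≤_) (sym (ones-gamma n s s≤n)) k<s))

  Middle : Tuple n → Set
  Middle y = ones y ≡ k ⊎ ones y ≡ suc k

  right-middle∈T : ∀ y → hasOne m y ≡ true → Middle y →
    T′ₛ n s y ∨ T″ₛ n s y ≡ true
  right-middle∈T y right (inj₁ level) =
    ∨-trueˡ (T″ₛ n s y) (T′-intro y level (right-incomparable y right (m≤n⇒m≤1+n (≤-reflexive level))))
  right-middle∈T y right (inj₂ level) =
    ∨-trueʳ (T′ₛ n s y) (T″-intro y level (right-incomparable y right (≤-reflexive level)))

  module Bound (S′ S″ : TSet n) (S∈A : InA n s S′ S″) where

    A : TSet n
    A a = S′ a ∨ S″ a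

    A-right : ∀ a → A a ≡ true → a ≢ γ → hasOne m a ≡ true
    A-right a a∈A a≢γ with hasOne m a in right
    ... | true = refl
    ... | false = ⊥-elim (a≢γ (InA-below-gamma {s = s} S′ S″ S∈A a a∈A (¬hasOne⇒below-gamma n s s≤n a right)))

    R : TSet n
    R a = A a ∧ hasOne m a

    R⊆A : ∀ a → R a ≡ true → A a ≡ true
    R⊆A a = BP.∧-conicalˡ (A a) _

    R-right : ∀ a → R a ≡ true → hasOne m a ≡ true
    R-right a = BP.∧-conicalʳ (A a) _

    -- distinct positions of a chain carry distinct comparable tuples, so at most
    -- two positions of a chain hold members of R
    R-no-three-on-chain : ∀ c → Valid c → ∀ i j l → i < j → j < l → l ≤ width c →
      R (at c i) ≡ true → R (at c j) ≡ true → R (at c l) ≡ true → ⊥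
    R-no-three-on-chain c v i j l i<j j<l l≤w Ri Rj Rl =
      InA-no-three {s = s} S′ S″ S∈A (at c i) (at c j) (at c l) (R⊆A _ Ri) (R⊆A _ Rj) (R⊆A _ Rl)
        (at-mono c i j (<⇒≤ i<j)) (at-mono c j l (<⇒≤ j<l))
        (λ e → <⇒≢ i<j (at-injective c i j v i≤w j≤w e)) (λ e → <⇒≢ j<l (at-injective c j l v j≤w l≤w e))
      where
      j≤w = ≤-trans (<⇒≤ j<l) l≤w
      i≤w = ≤-trans (<⇒≤ i<j) j≤w

    middle : Chain n → ℕ
    middle c = k ∸ forced c

    module OnChain (c : Chain n) (v : Valid c) = Selection
      (width c) (middle c) (n % 2)
      (symmetric-length n (forced c) (width c) (chain-symmetric c v)) (parity≤1 n)
      (λ j → hasOne m (at c j)) (λ j → R (at c j))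
      (hasOne-profile m c) (λ j → R-right (at c j)) (R-no-three-on-chain c v)

    selected : Chain n → ℕ → ℕ
    selected c = target (middle c) (λ j → hasOne m (at c j)) (λ j → R (at c j))

    selected-middle : ∀ c i → Valid c → i ≤ width c → R (at c i) ≡ true →
      selected c i ≤ width c × hasOne m (at c (selected c i)) ≡ true × Middle (at c (selected c i))
    selected-middle c i v i≤w Ri with OnChain.target-admissible c v i i≤w Ri
    ... | t≤w , right , position = t≤w , right , map-⊎ on-k on-k+1 position
      where
      k≡ : forced c + middle c ≡ k
      k≡ = m+[n∸m]≡n (symmetric-start≤middle n (forced c) (width c) (chain-symmetric c v))
      on-k : selected c i ≡ middle c → ones (at c (selected c i)) ≡ k
      on-k t≡d = trans (ones-at c _ v t≤w) (trans (cong (forced c +_) t≡d) k≡)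
      on-k+1 : selected c i ≡ suc (middle c) → ones (at c (selected c i)) ≡ suc k
      on-k+1 t≡d+1 = trans (ones-at c _ v t≤w)
        (trans (cong (forced c +_) t≡d+1) (trans (+-suc (forced c) (middle c)) (cong suc k≡)))

    -- selection is injective across all chains, since chain and position
    -- of the selected tuple are recovered by locate
    selected-injective : ∀ c c′ i i′ → Valid c → Valid c′ → i ≤ width c → i′ ≤ width c′ →
      R (at c i) ≡ true → R (at c′ i′) ≡ true →
      at c (selected c i) ≡ at c′ (selected c′ i′) → (c , i) ≡ (c′ , i′)
    selected-injective c c′ i i′ v v′ i≤w i′≤w Ri Ri′ e with cong proj₁ same | cong proj₂ same
      where
      same : (c , selected c i) ≡ (c′ , selected c′ i′)
      same = trans (sym (locate-at c _ v (proj₁ (selected-middle c i v i≤w Ri))))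
               (trans (cong locate e) (locate-at c′ _ v′ (proj₁ (selected-middle c′ i′ v′ i′≤w Ri′))))
    ... | refl | same-position =
      cong (c ,_) (OnChain.target-injective c v i i′ i≤w i′≤w Ri Ri′ same-position)

    embed : Tuple n → Tuple n
    embed x = at (chainOf x) (selected (chainOf x) (positionOf x))

    R-located : ∀ x → R x ≡ true → R (at (chainOf x) (positionOf x)) ≡ true
    R-located x = subst (λ t → R t ≡ true) (sym (at-locate x))

    embed-middle : ∀ x → R x ≡ true → hasOne m (embed x) ≡ true × Middle (embed x)
    embed-middle x x∈R =
      proj₂ (selected-middle (chainOf x) (positionOf x) (proj₁ (locate-valid x)) (proj₂ (locate-valid x)) (R-located x x∈R))

    embed-injective : ∀ x y → R x ≡ true → R y ≡ true → embed x ≡ embed y → x ≡ y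
    embed-injective x y x∈R y∈R e = begin
        x                                ≡⟨ at-locate x ⟨
        at (chainOf x) (positionOf x)    ≡⟨ cong (λ p → at (proj₁ p) (proj₂ p)) same-place ⟩
        at (chainOf y) (positionOf y)    ≡⟨ at-locate y ⟩
        y                                ∎
      where
      open ≡-Reasoning
      same-place : locate x ≡ locate y
      same-place = selected-injective (chainOf x) (chainOf y) (positionOf x) (positionOf y)
        (proj₁ (locate-valid x)) (proj₁ (locate-valid y)) (proj₂ (locate-valid x)) (proj₂ (locate-valid y))
        (R-located x x∈R) (R-located y y∈R) e

    -- Extend the embedding by γ̃_s ↦ γ̃_s; this maps A injectively into T′ ∪ T″,
    -- because γ̃_s is not right of itself while every embedded tuple is.
    embedA : Tuple n → Tuple n
    embedA x with x ≟ᵗ γ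
    ... | yes _ = γ
    ... | no _ = embed x

    R-of-A : ∀ a → A a ≡ true → a ≢ γ → R a ≡ true
    R-of-A a a∈A a≢γ = ∧-true⁺ a∈A (A-right a a∈A a≢γ)

    embedA-into-T : ∀ a → A a ≡ true → T′ₛ n s (embedA a) ∨ T″ₛ n s (embedA a) ≡ true
    embedA-into-T a a∈A with a ≟ᵗ γ
    ... | yes _ = ∨-trueˡ (T″ₛ n s γ) γ∈T′
    ... | no a≢γ = uncurry (right-middle∈T (embed a)) (embed-middle a (R-of-A a a∈A a≢γ))

    γ-not-embedded : ∀ a → R a ≡ true → γ ≢ embed a
    γ-not-embedded a a∈R γ≡ =
      true≢false (trans (sym (proj₁ (embed-middle a a∈R))) (subst (λ t → hasOne m t ≡ false) γ≡ γ-not-right))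

    embedA-injective : ∀ a b → A a ≡ true → A b ≡ true → embedA a ≡ embedA b → a ≡ b
    embedA-injective a b a∈A b∈A e with a ≟ᵗ γ | b ≟ᵗ γ
    ... | yes a≡γ | yes b≡γ = trans a≡γ (sym b≡γ)
    ... | yes _   | no b≢γ  = ⊥-elim (γ-not-embedded b (R-of-A b b∈A b≢γ) e)
    ... | no a≢γ  | yes _   = ⊥-elim (γ-not-embedded a (R-of-A a a∈A a≢γ) (sym e))
    ... | no a≢γ  | no b≢γ  = embed-injective a b (R-of-A a a∈A a≢γ) (R-of-A b b∈A b≢γ) e

    bound : card S′ + card S″ ≤ card (T′ₛ n s) + card (T″ₛ n s)
    bound = begin
        card S′ + card S″                    ≡⟨ card-disjoint-union S′ S″ (InA-disjoint {s = s} S′ S″ S∈A) ⟩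
        card A                               ≤⟨ card-injection A _ embedA embedA-into-T embedA-injective ⟩
        card (λ a → T′ₛ n s a ∨ T″ₛ n s a)   ≡⟨ card-disjoint-union (T′ₛ n s) (T″ₛ n s)
                                                  (InA-disjoint {s = s} (T′ₛ n s) (T″ₛ n s) extremal-pair-in-A) ⟨
        card (T′ₛ n s) + card (T″ₛ n s)      ∎
      where open ≤-Reasoning

-- Corollary 5: for n/2 < s ≤ n the pair (T′, T″) lies in 𝒜_s and has maximum
-- cardinality there.  (The hypothesis 1 ≤ n follows from the others.)
corollary5 : (n s : ℕ) → 1 ≤ n → n < 2 * s → s ≤ n →
    InA n s (T′ₛ n s) (T″ₛ n s) ×
    (∀ (S′ S″ : TSet n) → InA n s S′ S″ →
      card S′ + card S″ ≤ card (T′ₛ n s) + card (T″ₛ n s))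
corollary5 n s _ n<2s s≤n =
  extremal-pair-in-A , λ S′ S″ S∈A → Bound.bound S′ S″ S∈A
  where open Extremal n s s≤n (middle<s n s n<2s)
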